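{- Let $n\ge1$, $X=\{1,\ldots,n\}$, and let $S$ be the vertex set of a permutograph on $S_n$. A function $F:S\to X$ is a discrete piecewise linear function if and only if it satisfies the separation property.
   Context: A permutation $\alpha$ of $X$ is written $\alpha=(x_1\cdots x_n)$ with $x_k=k\alpha$ (permutations act on the right and are composed left to right, so $x(\alpha\beta)=(x\alpha)\beta$). It defines the linear order $<_\alpha$ on $X$: $x_i<_\alpha x_j\iff i<j$; $\le_\alpha,\ge_\alpha$ accordingly. A pair $\{x,y\}\subseteq X$ is an inversion for $\{\alpha,\beta\}$ if $x,y$ appear in reverse order in $\alpha$ and $\beta$; the distance $d(\alpha,\beta)$ is the number of inversions. An ordered partition of $(X,<)$ is a partition $\pi=(X_1,\ldots,X_m)$ into nonempty sets such that $x\in X_i$, $y\in X_j$, $i<j$ imply $x<y$; it is trivial if it is $(\{1\},\ldots,\{n\})$. For a nontrivial ordered partition $\pi$, $\tau_\pi$ is the permutation reversing the order of the elements within each block $X_i$. Permutations $\alpha,\beta$ are $\pi$-adjacent if $\alpha\beta^{ -1}=\tau_\pi$ for a nontrivial ordered partition $\pi$, and adjacent if they are $\pi$-adjacent for some such $\pi$. The big permutograph $\Upsilon_n$ is the graph on $S_n$ whose edges are the adjacent pairs, each edge $\alpha\beta$ having weight $d(\alpha,\beta)$. A permutograph on $S_n$ is an isometric weighted subgraph of $\Upsilon_n$, i.e. a subgraph such that for any two of its vertices $\alpha,\beta$ the minimum total weight of a path between them inside the subgraph equals their weighted path distance in $\Upsilon_n$ (which equals $d(\alpha,\beta)$). For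 a set $Y\subseteq X$, $Y\alpha=\{y\alpha:y\in Y\}$. A function $F:S\to X$ is a discrete piecewise linear function (DPL-function) if for any two $\pi$-adjacent permutations $\alpha,\beta\in S$ with $\pi=(X_1,\ldots,X_m)$ there is $1\le i\le m$ with $F(\alpha)\in X_i\alpha$ and $F(\beta)\in X_i\beta$. $F$ satisfies the separation property if for any $\alpha,\beta\in S$ there is $u\in X$ with $u\le_\alpha F(\alpha)$ and $u\ge_\beta F(\beta)$. -}

module Defs where

open import Data.Nat using (ℕ; zero; suc; _+_; _∸_; _≤_; _<_)
import Data.Nat as ℕ
open import Data.Fin as Fin using (Fin; toℕ)
open import Data.Vec using (Vec; []; _∷_; lookup)
open import Data.List using (List; length; filter; allFin; cartesianProduct)
open import Data.Product using (Σ; ∃; _×_; _,_; proj₁; proj₂)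
open import Data.Sum using (_⊎_)
open import Relation.Nullary using (¬_; yes; no)
open import Relation.Nullary.Decidable using (_×-dec_)
open import Relation.Binary.PropositionalEquality using (_≡_)

-- X = Fin n (elements 1..n are 0..n-1).
-- A permutation α = (x_1 ⋯ x_n) is represented by its word: a vector w with
-- lookup w k = x_k = kα, whose entries are pairwise distinct.
Word : ℕ → Set
Word n = Vec (Fin n) n

IsPerm : ∀ {n} → Word n → Set
IsPerm {n} w = ∀ (i j : Fin n) → lookup w i ≡ lookup w j → i ≡ j

index : ∀ {n m} → Vec (Fin n) m → Fin n → ℕ
index [] x = zero
index (y ∷ ys) x with y Fin.≟ x
... | yes _ = zero
... | no _  = suc (index ys x)

_<[_]_ : ∀ {n} → Fin n → Word n → Fin n → Set
x <[ α ] y = index α x < index α y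

_≤[_]_ : ∀ {n} → Fin n → Word n → Fin n → Set
x ≤[ α ] y = index α x ≤ index α y

count : ∀ {n} {P : Fin n → Set} → (∀ x → Relation.Nullary.Dec (P x)) → ℕ
count {n} P? = length (filter P? (allFin n))

-- distance: number of inversions {x,y}; each unordered inversion is counted
-- exactly once as the ordered pair (x,y) with x <_α y and y <_β x.
d : ∀ {n} → Word n → Word n → ℕ
d {n} α β = length (filter (λ p → (index α (proj₁ p) ℕ.<? index α (proj₂ p))
                                   ×-dec (index β (proj₂ p) ℕ.<? index β (proj₁ p)))
                           (cartesianProduct (allFin n) (allFin n)))

-- ordered partition (X_1,…,X_m) of (X,<): blk x = i iff x ∈ X_i
record OrderedPartition (n : ℕ) : Set where
  field
    m       : ℕ
    blk     : Fin n → Fin m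
    nonempty : ∀ (i : Fin m) → ∃ λ x → blk x ≡ i
    ordered  : ∀ (x y : Fin n) → blk x Fin.< blk y → x Fin.< y
open OrderedPartition public

Trivial : ∀ {n} → OrderedPartition n → Set
Trivial {n} π = ∀ (x y : Fin n) → blk π x ≡ blk π y → x ≡ y

-- τ_π reverses each block: the block of x is the interval [lo, hi] with
-- lo = #{z : blk z < blk x}, hi + 1 = #{z : blk z ≤ blk x}; x τ_π = lo + hi − x.
τ : ∀ {n} → OrderedPartition n → Fin n → ℕ
τ π x = (count (λ z → blk π z Fin.<? blk π x) + count (λ z → blk π z Fin.≤? blk π x))
        ∸ suc (toℕ x)

-- α, β are π-adjacent: α β⁻¹ = τ_π, i.e. for every k, (kα)β⁻¹ = kτ_π
-- (β⁻¹ sends an element to its position in β).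
PiAdjacent : ∀ {n} → OrderedPartition n → Word n → Word n → Set
PiAdjacent {n} π α β = ¬ Trivial π × (∀ (k : Fin n) → index β (lookup α k) ≡ τ π k)

Adjacent : ∀ {n} → Word n → Word n → Set
Adjacent {n} α β = Σ (OrderedPartition n) λ π → PiAdjacent π α β

data Path {n} (E : Word n → Word n → Set) : Word n → Word n → Set where
  [] : ∀ {a} → Path E a a
  _∷_ : ∀ {a b c} → (E a b ⊎ E b a) → Path E b c → Path E a c

weight : ∀ {n} {E : Word n → Word n → Set} {a b} → Path E a b → ℕ
weight [] = zero
weight (_∷_ {a} {b} _ p) = d a b + weight p

-- (V,E) is a permutograph on S_n: a subgraph of Υ_n that is isometric,
-- i.e. the minimum weight of a path inside it between two of its vertices
-- equals their weighted path distance in Υ_n, which is d(α,β).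
IsPermutograph : ∀ {n} → (Word n → Set) → (Word n → Word n → Set) → Set
IsPermutograph {n} V E =
    (∀ w → V w → IsPerm w)
  × (∀ a b → E a b → V a × V b × Adjacent a b)
  × (∀ a b → V a → V b →
       (Σ (Path E a b) λ p → weight p ≡ d a b)
     × (∀ (p : Path E a b) → d a b ≤ weight p))

InBlockImage : ∀ {n} → (π : OrderedPartition n) → Fin (m π) → Word n → Fin n → Set
InBlockImage π i α u = ∃ λ y → blk π y ≡ i × lookup α y ≡ u

-- F : S → X (values outside S are irrelevant)
IsDPL : ∀ {n} → (Word n → Set) → (Word n → Fin n) → Set
IsDPL {n} S F = ∀ α β → S α → S β → (π : OrderedPartition n) → PiAdjacent π α β →
  ∃ λ (i : Fin (m π)) → InBlockImage π i α (F α) × InBlockImage π i β (F β)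

Separation : ∀ {n} → (Word n → Set) → (Word n → Fin n) → Set
Separation {n} S F = ∀ α β → S α → S β →
  ∃ λ (u : Fin n) → u ≤[ α ] F α × F β ≤[ β ] u

-- Call a pair (α, a), (β, b) of a word and a letter *crossed* if some letter
-- u satisfies u ≤_α a and b ≤_β u; separation asks that (α, F α), (β, F β)
-- be crossed for all α, β ∈ S.  The proof rests on two facts.
--
--  * Local (one edge).  If α, β are π-adjacent then a ∈ X_i α and b ∈ X_i β
--    for a common block X_i iff (α, a), (β, b) are crossed in both directions:
--    τ_π maps every block onto itself (so positions of one letter in α and β
--    lie in the same block), and the first and last position of a block are
--    exchanged by τ_π (which provides the crossing letters).
--  * Global (geodesics).  If d(α,γ) + d(γ,β) ≤ d(α,β), crossing passes from
--    (α,γ) and (γ,β) to (α,β): otherwise the two crossing letters form an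
--    inversion of α, γ that is not one of α, β, which makes the triangle
--    inequality for the inversion count d strict.
--
-- Separation gives DPL by the local fact alone; DPL gives separation by
-- walking along a minimum-weight path of the permutograph, which exists by
-- isometry and is a geodesic for d on every suffix.

module Submission where

open import Defs
open import Data.Nat as ℕ using (ℕ; suc; _+_; _∸_; _≤_; _<_; z≤n; s≤s; s≤s⁻¹)
import Data.Nat.Properties as ℕP
open import Data.Fin as Fin using (Fin; toℕ; fromℕ<)
import Data.Fin.Properties as FinP
import Data.Vec as Vec
open import Data.Vec using (Vec; lookup)
open import Data.List using (List; []; _∷_; length; filter; tabulate; allFin; cartesianProduct)
open import Data.List.Properties using (filter-none; length-filter; length-tabulate)
open import Data.List.Relation.Unary.All.Properties using (tabulate⁺)
open import Data.List.Relation.Unary.Any using (here; there)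
open import Data.List.Membership.Propositional using (_∈_)
open import Data.List.Membership.Propositional.Properties using (∈-allFin; ∈-cartesianProduct⁺)
open import Algebra.Properties.CommutativeSemigroup ℕP.+-commutativeSemigroup using (interchange)
open import Data.Product using (∃; ∃₂; _×_; _,_; proj₁; proj₂)
open import Data.Sum using (_⊎_; inj₁; inj₂)
open import Data.Empty using (⊥-elim)
open import Function using (_∘_; id)
open import Function.Definitions using (Injective)
open import Function.Bundles using (_⇔_; mk⇔; Equivalence)
open import Relation.Nullary using (¬_; Dec; yes; no; contradiction)
open import Relation.Nullary.Decidable using (_×-dec_)
open import Relation.Unary using (Decidable)
open import Relation.Binary.Definitions using (tri<; tri≈; tri>)
open import Relation.Binary.PropositionalEquality

open Equivalence using (to; from)

index-lookup-≤ : ∀ {n m} (w : Vec (Fin n) m) k → index w (lookup w k) ≤ toℕ k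
index-lookup-≤ (y Vec.∷ ys) Fin.zero with y Fin.≟ y
... | yes _   = z≤n
... | no y≢y  = contradiction refl y≢y
index-lookup-≤ (y Vec.∷ ys) (Fin.suc k) with y Fin.≟ lookup ys k
... | yes _ = z≤n
... | no _  = s≤s (index-lookup-≤ ys k)

lookup-index : ∀ {n m} (w : Vec (Fin n) m) x (k : Fin m) → toℕ k ≡ index w x → lookup w k ≡ x
lookup-index (y Vec.∷ ys) x k k≡ with y Fin.≟ x
lookup-index (y Vec.∷ ys) x Fin.zero    _  | yes y≡x = y≡x
lookup-index (y Vec.∷ ys) x (Fin.suc k) () | yes _
lookup-index (y Vec.∷ ys) x Fin.zero    () | no _
lookup-index (y Vec.∷ ys) x (Fin.suc k) k≡ | no _ = lookup-index ys x k (ℕP.suc-injective k≡)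

index-lookup : ∀ {n} (w : Word n) → IsPerm w → ∀ k → index w (lookup w k) ≡ toℕ k
index-lookup {n} w w-perm k = begin
  index w (lookup w k) ≡⟨ sym (FinP.toℕ-fromℕ< i<n) ⟩
  toℕ j                ≡⟨ cong toℕ (w-perm j k (lookup-index w _ j (FinP.toℕ-fromℕ< i<n))) ⟩
  toℕ k                ∎
  where
  open ≡-Reasoning
  i<n : index w (lookup w k) < n
  i<n = ℕP.≤-<-trans (index-lookup-≤ w k) (FinP.toℕ<n k)
  j : Fin n
  j = fromℕ< i<n

index-at : ∀ {n} (w : Word n) → IsPerm w → ∀ {k x} → lookup w k ≡ x → index w x ≡ toℕ k
index-at w w-perm {k} refl = index-lookup w w-perm k

-- A permutation word contains every letter: omitting x would give an
-- injection Fin (suc n) → Fin n.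
lookup-surjective : ∀ {n} (w : Word n) → IsPerm w → ∀ x → ∃ λ k → lookup w k ≡ x
lookup-surjective {suc n} w w-perm x with FinP.any? (λ k → lookup w k Fin.≟ x)
... | yes found  = found
... | no missing = contradiction (FinP.injective⇒≤ avoid-injective) ℕP.1+n≰n
  where
  x≢ : ∀ k → x ≢ lookup w k
  x≢ k x≡ = missing (k , sym x≡)
  avoid : Fin (suc n) → Fin n
  avoid k = Fin.punchOut (x≢ k)
  avoid-injective : Injective _≡_ _≡_ avoid
  avoid-injective {i} {j} eq = w-perm i j (FinP.punchOut-injective (x≢ i) (x≢ j) eq)

position : ∀ {n} (w : Word n) → IsPerm w → ∀ x → ∃ λ k → lookup w k ≡ x × index w x ≡ toℕ k
position w w-perm x with lookup-surjective w w-perm x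
... | k , at = k , at , index-at w w-perm at

index-injective : ∀ {n} (w : Word n) → IsPerm w → ∀ x y → index w x ≡ index w y → x ≡ y
index-injective w w-perm x y eq with position w w-perm x | position w w-perm y
... | k , refl , ik | l , refl , il = cong (lookup w) (FinP.toℕ-injective (trans (sym ik) (trans eq il)))

count-initial : ∀ {A : Set} {P : A → Set} (P? : Decidable P) {m} (f : Fin m → A) →
  (∀ z z' → toℕ z' ≤ toℕ z → P (f z) → P (f z')) →
  ∀ z → P (f z) ⇔ toℕ z < length (filter P? (tabulate f))
count-initial P? {suc m} f down z with P? (f Fin.zero)
count-initial P? f down Fin.zero                | yes P0 = mk⇔ (λ _ → s≤s z≤n) (λ _ → P0)
count-initial {P = P} P? f down (Fin.suc z) | yes _  = mk⇔ (s≤s ∘ to rest) (from rest ∘ s≤s⁻¹)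
  where
  rest : P (f (Fin.suc z)) ⇔ toℕ z < length (filter P? (tabulate (f ∘ Fin.suc)))
  rest = count-initial P? (f ∘ Fin.suc) (λ z z' z'≤z → down (Fin.suc z) (Fin.suc z') (s≤s z'≤z)) z
count-initial P? f down z | no ¬P0 =
  mk⇔ (λ Pz → contradiction (down z Fin.zero z≤n Pz) ¬P0)
      (λ z<# → ⊥-elim (ℕP.n≮0 (subst (toℕ z <_) (cong length none) z<#)))
  where
  none : filter P? (tabulate (f ∘ Fin.suc)) ≡ []
  none = filter-none P? (tabulate⁺ (λ z Pz → ¬P0 (down (Fin.suc z) Fin.zero z≤n Pz)))

-- The reflection x ↦ l + h ∸ suc x (τ_π on a block [l, h)) maps [l, h) into itself.
reflect-bounds : ∀ {l x h} → l ≤ x → x < h → l ≤ l + h ∸ suc x × l + h ∸ suc x < h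
reflect-bounds {l} {x} {h} l≤x x<h rewrite ℕP.+-∸-assoc l x<h =
  ℕP.m≤m+n l (h ∸ suc x) ,
  subst (l + (h ∸ suc x) <_) (ℕP.m+[n∸m]≡n x<h) (ℕP.+-monoˡ-< (h ∸ suc x) (s≤s l≤x))

reflect-first : ∀ l {y h} → y < h → y ≤ l + h ∸ suc l
reflect-first l {y} {h} y<h =
  subst (y ≤_) (sym (trans (cong (l + h ∸_) (ℕP.+-comm 1 l)) (ℕP.[m+n]∸[m+o]≡n∸o l h 1)))
        (ℕP.∸-monoˡ-≤ 1 y<h)

reflect-last : ∀ l {h} → 0 < h → l + h ∸ suc (h ∸ 1) ≡ l
reflect-last l {suc h} _ = ℕP.m+n∸n≡m l (suc h)

below-last : ∀ {z h} → z < h → z ≤ h ∸ 1 × h ∸ 1 < h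
below-last {h = suc h} z<h = s≤s⁻¹ z<h , ℕP.n<1+n h

module Blocks {n} (π : OrderedPartition n) where

  blk-mono : ∀ {z' z} → toℕ z' ≤ toℕ z → blk π z' Fin.≤ blk π z
  blk-mono {z'} {z} z'≤z = ℕP.≮⇒≥ (λ lt → ℕP.<⇒≱ (ordered π z z' lt) z'≤z)

  -- Block b occupies the positions [start b, end b).
  start end : Fin (m π) → ℕ
  start b = count (λ z → blk π z Fin.<? b)
  end   b = count (λ z → blk π z Fin.≤? b)

  below-start : ∀ b z → blk π z Fin.< b ⇔ toℕ z < start b
  below-start b = count-initial (λ z → blk π z Fin.<? b) id
    (λ _ _ z'≤z → ℕP.≤-<-trans (blk-mono z'≤z))

  below-end : ∀ b z → blk π z Fin.≤ b ⇔ toℕ z < end b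
  below-end b = count-initial (λ z → blk π z Fin.≤? b) id
    (λ _ _ z'≤z → ℕP.≤-trans (blk-mono z'≤z))

  end≤n : ∀ b → end b ≤ n
  end≤n b = ℕP.≤-trans (length-filter (λ z → blk π z Fin.≤? b) (allFin n))
                       (ℕP.≤-reflexive (length-tabulate id))

  block-interval : ∀ b z → blk π z ≡ b ⇔ (start b ≤ toℕ z × toℕ z < end b)
  block-interval b z = mk⇔ into out
    where
    into : blk π z ≡ b → start b ≤ toℕ z × toℕ z < end b
    into refl = ℕP.≮⇒≥ (FinP.<-irrefl refl ∘ from (below-start b z)) , to (below-end b z) ℕP.≤-refl
    out : start b ≤ toℕ z × toℕ z < end b → blk π z ≡ b
    out (s≤z , z<e) =
      FinP.≤-antisym (from (below-end b z) z<e)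
                     (ℕP.≮⇒≥ (λ z<b → ℕP.<⇒≱ (to (below-start b z) z<b) s≤z))

  τ-on-block : ∀ {b} z → blk π z ≡ b → τ π z ≡ start b + end b ∸ suc (toℕ z)
  τ-on-block z refl = refl

  τ-block : ∀ x (j : Fin n) → toℕ j ≡ τ π x → blk π j ≡ blk π x
  τ-block x j j≡ = from (block-interval (blk π x) j)
    (subst (λ t → start (blk π x) ≤ t × t < end (blk π x)) (sym j≡) (reflect-bounds s≤x x<e))
    where
    s≤x : start (blk π x) ≤ toℕ x
    s≤x = proj₁ (to (block-interval (blk π x) x) refl)
    x<e : toℕ x < end (blk π x)
    x<e = proj₂ (to (block-interval (blk π x) x) refl)

  first-of-block : ∀ {b y} → blk π y ≡ b →
    ∃ λ f → ∀ z → blk π z ≡ b → toℕ f ≤ toℕ z × toℕ z ≤ τ π f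
  first-of-block {b} {y} y∈b = f , λ z z∈b →
    subst (_≤ toℕ z) (sym f≡) (proj₁ (to (block-interval b z) z∈b)) ,
    subst (toℕ z ≤_) (sym τf) (reflect-first (start b) (proj₂ (to (block-interval b z) z∈b)))
    where
    y-in : start b ≤ toℕ y × toℕ y < end b
    y-in = to (block-interval b y) y∈b
    s<n : start b < n
    s<n = ℕP.≤-<-trans (proj₁ y-in) (FinP.toℕ<n y)

    f : Fin n
    f = fromℕ< s<n
    f≡ : toℕ f ≡ start b
    f≡ = FinP.toℕ-fromℕ< s<n
    f∈b : blk π f ≡ b
    f∈b = from (block-interval b f)
      (ℕP.≤-reflexive (sym f≡) , subst (_< end b) (sym f≡) (ℕP.≤-<-trans (proj₁ y-in) (proj₂ y-in)))
    τf : τ π f ≡ start b + end b ∸ suc (start b)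
    τf = trans (τ-on-block f f∈b) (cong (λ t → start b + end b ∸ suc t) f≡)

  last-of-block : ∀ {b y} → blk π y ≡ b →
    ∃ λ l → ∀ z → blk π z ≡ b → τ π l ≤ toℕ z × toℕ z ≤ toℕ l
  last-of-block {b} {y} y∈b = l , λ z z∈b →
    subst (_≤ toℕ z) (sym τl) (proj₁ (to (block-interval b z) z∈b)) ,
    subst (toℕ z ≤_) (sym l≡) (proj₁ (below-last (proj₂ (to (block-interval b z) z∈b))))
    where
    y-in : start b ≤ toℕ y × toℕ y < end b
    y-in = to (block-interval b y) y∈b
    0<e : 0 < end b
    0<e = ℕP.≤-<-trans z≤n (proj₂ y-in)
    last : toℕ y ≤ end b ∸ 1 × end b ∸ 1 < end b
    last = below-last (proj₂ y-in)
    l<n : end b ∸ 1 < n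
    l<n = ℕP.<-≤-trans (proj₂ last) (end≤n b)
    l : Fin n
    l = fromℕ< l<n
    l≡ : toℕ l ≡ end b ∸ 1
    l≡ = FinP.toℕ-fromℕ< l<n
    l∈b : blk π l ≡ b
    l∈b = from (block-interval b l)
      (subst (start b ≤_) (sym l≡) (ℕP.≤-trans (proj₁ y-in) (proj₁ last)) ,
       subst (_< end b) (sym l≡) (proj₂ last))
    τl : τ π l ≡ start b
    τl = trans (τ-on-block l l∈b)
               (trans (cong (λ t → start b + end b ∸ suc t) l≡) (reflect-last (start b) 0<e))

Crossed : ∀ {n} → Word n → Fin n → Word n → Fin n → Set
Crossed α a β b = ∃ λ u → u ≤[ α ] a × b ≤[ β ] u

module Adjacency {n} (π : OrderedPartition n) (α β : Word n)
                 (α-perm : IsPerm α) (β-perm : IsPerm β) (adj : PiAdjacent π α β) where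

  open Blocks π

  same-block : ∀ x → ∃₂ λ k j → index α x ≡ toℕ k × index β x ≡ toℕ j × blk π j ≡ blk π k
  same-block x with position α α-perm x | position β β-perm x
  ... | k , refl , αk | j , _ , βj = k , j , αk , βj , τ-block k j (trans (sym βj) (proj₂ adj k))

  crossed-block-≤ : ∀ {a b} p q → index α a ≡ toℕ p → index β b ≡ toℕ q →
    Crossed α a β b → blk π q Fin.≤ blk π p
  crossed-block-≤ p q αa βb (u , u≤a , b≤u) with same-block u
  ... | k , j , αu , βu , j~k =
    ℕP.≤-trans (blk-mono (subst₂ _≤_ βb βu b≤u))
               (subst (Fin._≤ blk π p) (sym j~k) (blk-mono (subst₂ _≤_ αu αa u≤a)))

  crossed-block-≥ : ∀ {a b} p q → index α a ≡ toℕ p → index β b ≡ toℕ q →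
    Crossed β b α a → blk π p Fin.≤ blk π q
  crossed-block-≥ p q αa βb (v , v≤b , a≤v) with same-block v
  ... | k , j , αv , βv , j~k =
    ℕP.≤-trans (blk-mono (subst₂ _≤_ αa αv a≤v))
               (subst (Fin._≤ blk π q) j~k (blk-mono (subst₂ _≤_ βv βb v≤b)))

  -- The first and last letters of a common block provide the crossings.
  block-crossed : ∀ {a b} p q → lookup α p ≡ a → lookup β q ≡ b → blk π p ≡ blk π q →
    Crossed α a β b × Crossed β b α a
  block-crossed {a} {b} p q αp βq p~q with first-of-block p~q | last-of-block p~q
  ... | f , first | l , last =
    (lookup α f , at-α f (proj₁ (first p p~q)) , at-β f (proj₂ (first q refl))) ,
    (lookup α l , at-β' l (proj₁ (last q refl)) , at-α' l (proj₂ (last p p~q)))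
    where
    αa : index α a ≡ toℕ p
    αa = index-at α α-perm αp
    βb : index β b ≡ toℕ q
    βb = index-at β β-perm βq
    at-α : ∀ k → toℕ k ≤ toℕ p → lookup α k ≤[ α ] a
    at-α k k≤p = subst₂ _≤_ (sym (index-lookup α α-perm k)) (sym αa) k≤p
    at-α' : ∀ k → toℕ p ≤ toℕ k → a ≤[ α ] lookup α k
    at-α' k p≤k = subst₂ _≤_ (sym αa) (sym (index-lookup α α-perm k)) p≤k
    at-β : ∀ k → toℕ q ≤ τ π k → b ≤[ β ] lookup α k
    at-β k q≤τ = subst₂ _≤_ (sym βb) (sym (proj₂ adj k)) q≤τ
    at-β' : ∀ k → τ π k ≤ toℕ q → lookup α k ≤[ β ] b
    at-β' k τ≤q = subst₂ _≤_ (sym (proj₂ adj k)) (sym βb) τ≤q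

  same-block⇔crossed : ∀ a b →
    (∃ λ i → InBlockImage π i α a × InBlockImage π i β b) ⇔ (Crossed α a β b × Crossed β b α a)
  same-block⇔crossed a b = mk⇔ crossed blocked
    where
    crossed : (∃ λ i → InBlockImage π i α a × InBlockImage π i β b) → Crossed α a β b × Crossed β b α a
    crossed (i , (p , p∈i , αp) , (q , q∈i , βq)) = block-crossed p q αp βq (trans p∈i (sym q∈i))
    blocked : Crossed α a β b × Crossed β b α a → ∃ λ i → InBlockImage π i α a × InBlockImage π i β b
    blocked (ab , ba) with position α α-perm a | position β β-perm b
    ... | p , αp , αa | q , βq , βb =
      blk π p , (p , refl , αp) ,
      (q , FinP.≤-antisym (crossed-block-≤ p q αa βb ab) (crossed-block-≥ p q αa βb ba) , βq)

#[_] : ∀ {A : Set} {P : A → Set} → Decidable P → List A → ℕ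
#[ P? ] xs = length (filter P? xs)

⟦_⟧ : ∀ {B : Set} → Dec B → ℕ
⟦ yes _ ⟧ = 1
⟦ no _ ⟧  = 0

#-∷ : ∀ {A : Set} {P : A → Set} (P? : Decidable P) x xs → #[ P? ] (x ∷ xs) ≡ ⟦ P? x ⟧ + #[ P? ] xs
#-∷ P? x xs with P? x
... | yes _ = refl
... | no _  = refl

module Cover {A : Set} {P Q R : A → Set} (P? : Decidable P) (Q? : Decidable Q) (R? : Decidable R)
             (cover : ∀ x → P x → Q x ⊎ R x) where

  ⟦⟧-cover : ∀ x → ⟦ P? x ⟧ ≤ ⟦ Q? x ⟧ + ⟦ R? x ⟧
  ⟦⟧-cover x with P? x | Q? x | R? x | cover x
  ... | no _  | _      | _     | _ = z≤n
  ... | yes _ | yes _  | _     | _ = s≤s z≤n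
  ... | yes _ | no _   | yes _ | _ = s≤s z≤n
  ... | yes p | no ¬q  | no ¬r | c with c p
  ...   | inj₁ q = contradiction q ¬q
  ...   | inj₂ r = contradiction r ¬r

  ⟦⟧-strict : ∀ {x} → ¬ P x → Q x → ⟦ P? x ⟧ < ⟦ Q? x ⟧ + ⟦ R? x ⟧
  ⟦⟧-strict {x} ¬p q with P? x | Q? x
  ... | yes p | _     = contradiction p ¬p
  ... | no _  | yes _ = s≤s z≤n
  ... | no _  | no ¬q = contradiction q ¬q

  regroup : ∀ {_~_ : ℕ → ℕ → Set} x xs →
    (⟦ P? x ⟧ + #[ P? ] xs) ~ ((⟦ Q? x ⟧ + ⟦ R? x ⟧) + (#[ Q? ] xs + #[ R? ] xs)) →
    #[ P? ] (x ∷ xs) ~ (#[ Q? ] (x ∷ xs) + #[ R? ] (x ∷ xs))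
  regroup {_~_} x xs = subst₂ _~_ (sym (#-∷ P? x xs))
    (trans (interchange ⟦ Q? x ⟧ ⟦ R? x ⟧ (#[ Q? ] xs) (#[ R? ] xs))
           (sym (cong₂ _+_ (#-∷ Q? x xs) (#-∷ R? x xs))))

  #-cover : ∀ xs → #[ P? ] xs ≤ #[ Q? ] xs + #[ R? ] xs
  #-cover []       = z≤n
  #-cover (x ∷ xs) = regroup {_≤_} x xs (ℕP.+-mono-≤ (⟦⟧-cover x) (#-cover xs))

  #-cover-strict : ∀ {y} xs → y ∈ xs → ¬ P y → Q y → #[ P? ] xs < #[ Q? ] xs + #[ R? ] xs
  #-cover-strict (x ∷ xs) (here refl) ¬p q =
    regroup {_<_} x xs (ℕP.+-mono-<-≤ (⟦⟧-strict ¬p q) (#-cover xs))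
  #-cover-strict (x ∷ xs) (there y∈) ¬p q =
    regroup {_<_} x xs (ℕP.+-mono-≤-< (⟦⟧-cover x) (#-cover-strict xs y∈ ¬p q))

module Inversions {n : ℕ} where

  Inverted : Word n → Word n → Fin n × Fin n → Set
  Inverted α β p = index α (proj₁ p) < index α (proj₂ p) × index β (proj₂ p) < index β (proj₁ p)

  -- Decided exactly as in the definition of d.
  inverted? : ∀ α β → Decidable (Inverted α β)
  inverted? α β p =
    (index α (proj₁ p) ℕ.<? index α (proj₂ p)) ×-dec (index β (proj₂ p) ℕ.<? index β (proj₁ p))

  pairs : List (Fin n × Fin n)
  pairs = cartesianProduct (allFin n) (allFin n)

  inversion-split : ∀ α β γ → IsPerm γ → ∀ p → Inverted α β p → Inverted α γ p ⊎ Inverted γ β p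
  inversion-split α β γ γ-perm (x , y) (αxy , βyx) with ℕP.<-cmp (index γ x) (index γ y)
  ... | tri< γxy _ _ = inj₂ (γxy , βyx)
  ... | tri> _ _ γyx = inj₁ (αxy , γyx)
  ... | tri≈ _ γx≡γy _ with index-injective γ γ-perm x y γx≡γy
  ...   | refl = contradiction αxy (ℕP.<-irrefl refl)

  d-triangle : ∀ α β γ → IsPerm γ → d α β ≤ d α γ + d γ β
  d-triangle α β γ γ-perm =
    Cover.#-cover (inverted? α β) (inverted? α γ) (inverted? γ β) (inversion-split α β γ γ-perm) pairs

  d-triangle-strict : ∀ α β γ → IsPerm γ → ∀ x y →
    ¬ Inverted α β (x , y) → Inverted α γ (x , y) → d α β < d α γ + d γ β
  d-triangle-strict α β γ γ-perm x y =
    Cover.#-cover-strict (inverted? α β) (inverted? α γ) (inverted? γ β) (inversion-split α β γ γ-perm)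
      pairs (∈-cartesianProduct⁺ (∈-allFin x) (∈-allFin y))

open Inversions

crossed-geodesic : ∀ {n} (α β γ : Word n) {a b c} → IsPerm γ → d α γ + d γ β ≤ d α β →
  Crossed α a γ c → Crossed γ c β b → Crossed α a β b
crossed-geodesic α β γ γ-perm geodesic (u , u≤a , c≤u) (v , v≤c , b≤v)
  with index α v ℕ.≤? index α u
... | yes v≤u = v , ℕP.≤-trans v≤u u≤a , b≤v
... | no v≰u with index β v ℕ.≤? index β u
...   | yes βv≤βu = u , u≤a , ℕP.≤-trans b≤v βv≤βu
...   | no βv≰βu = contradiction geodesic (ℕP.<⇒≱ (d-triangle-strict α β γ γ-perm u v not-αβ αγ))
  where
  αu<αv : index α u < index α v
  αu<αv = ℕP.≰⇒> v≰u
  not-αβ : ¬ Inverted α β (u , v)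
  not-αβ (_ , βv<βu) = βv≰βu (ℕP.<⇒≤ βv<βu)
  γv<γu : index γ v < index γ u
  γv<γu = ℕP.≤∧≢⇒< (ℕP.≤-trans v≤c c≤u)
    (λ γv≡γu → v≰u (ℕP.≤-reflexive (cong (index α) (index-injective γ γ-perm v u γv≡γu))))
  αγ : Inverted α γ (u , v)
  αγ = αu<αv , γv<γu

module Permutograph {n} (S : Word n → Set) (E : Word n → Word n → Set)
                    (graph : IsPermutograph S E) (F : Word n → Fin n) where

  perm : ∀ α → S α → IsPerm α
  perm = proj₁ graph

  edge-target : ∀ {α γ} → E α γ ⊎ E γ α → S γ
  edge-target {α} {γ} (inj₁ e) = proj₁ (proj₂ (proj₁ (proj₂ graph) α γ e))
  edge-target {α} {γ} (inj₂ e) = proj₁ (proj₁ (proj₂ graph) γ α e)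

  edge-crossed : IsDPL S F → ∀ {α γ} → E α γ ⊎ E γ α → Crossed α (F α) γ (F γ)
  edge-crossed dpl {α} {γ} (inj₁ e) with proj₁ (proj₂ graph) α γ e
  ... | Sα , Sγ , π , adj =
    proj₁ (to (Adjacency.same-block⇔crossed π α γ (perm α Sα) (perm γ Sγ) adj (F α) (F γ))
              (dpl α γ Sα Sγ π adj))
  edge-crossed dpl {α} {γ} (inj₂ e) with proj₁ (proj₂ graph) γ α e
  ... | Sγ , Sα , π , adj =
    proj₂ (to (Adjacency.same-block⇔crossed π γ α (perm γ Sγ) (perm α Sα) adj (F γ) (F α))
              (dpl γ α Sγ Sα π adj))

  -- Along a minimum-weight path a DPL-function is crossed between the ends:
  -- every suffix is again of minimum weight, and each step lies on a geodesic.
  path-crossed : IsDPL S F → ∀ {α β} → S β → (p : Path E α β) → weight p ≤ d α β →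
    Crossed α (F α) β (F β)
  path-crossed dpl Sβ [] _ = _ , ℕP.≤-refl , ℕP.≤-refl
  path-crossed dpl {α} {β} Sβ (_∷_ {b = γ} e q) light =
    crossed-geodesic α β γ (perm γ Sγ) geodesic (edge-crossed dpl e) (path-crossed dpl Sβ q q-light)
    where
    Sγ : S γ
    Sγ = edge-target e
    q-heavy : d γ β ≤ weight q
    q-heavy = proj₂ (proj₂ (proj₂ graph) γ β Sγ Sβ) q
    q-light : weight q ≤ d γ β
    q-light = ℕP.+-cancelˡ-≤ (d α γ) _ _ (ℕP.≤-trans light (d-triangle α β γ (perm γ Sγ)))
    geodesic : d α γ + d γ β ≤ d α β
    geodesic = ℕP.≤-trans (ℕP.+-monoʳ-≤ (d α γ) q-heavy) light

  dpl⇒separation : IsDPL S F → Separation S F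
  dpl⇒separation dpl α β Sα Sβ with proj₁ (proj₂ (proj₂ graph) α β Sα Sβ)
  ... | p , weight≡d = path-crossed dpl Sβ p (ℕP.≤-reflexive weight≡d)

  separation⇒dpl : Separation S F → IsDPL S F
  separation⇒dpl sep α β Sα Sβ π adj =
    from (Adjacency.same-block⇔crossed π α β (perm α Sα) (perm β Sβ) adj (F α) (F β))
         (sep α β Sα Sβ , sep β α Sβ Sα)

theorem2 : (n : ℕ) → 1 ≤ n → (S : Word n → Set)
    → (∃ λ (E : Word n → Word n → Set) → IsPermutograph S E)
    → (F : Word n → Fin n) → IsDPL S F ⇔ Separation S F
theorem2 n _ S (E , graph) F = mk⇔ dpl⇒separation separation⇒dpl
  where open Permutograph S E graph F
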